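{- (Subject expansion for $\beta$.) If $N:\langle\Gamma\vdash U\rangle$ and $M\rhd_\beta^* N$, then $M:\langle\Gamma{\uparrow^{M}}\vdash U\rangle$.
   Context: Terms: $\mathcal V$ is a denumerably infinite set of variables; $\mathcal M$ is the set of untyped $\lambda$-terms $M::=x\mid \lambda x.M\mid MM$ taken modulo $\alpha$-conversion; $FV(M)$ is the set of free variables; $M[x:=N]$ is capture-avoiding substitution. $\rhd_\beta$ is the compatible closure of $(\lambda x.M)N\rhd_\beta M[x:=N]$ and $\rhd_\beta^*$ its reflexive-transitive closure. Types: $\mathcal A$ is a denumerably infinite set of atomic types; $\mathbb T::=a\mid \mathbb U\to\mathbb T$ ($a\in\mathcal A$) and $\mathbb U::=\omega\mid \mathbb U\sqcap\mathbb U\mid \mathbb T$; types are quotiented by commutativity, associativity and idempotence of $\sqcap$ and by $\omega\sqcap U=U$. $T$ ranges over $\mathbb T$, $U,V$ over $\mathbb U$. Environments: a type environment is a finite set $(x_i:U_i)_n$ of declarations with pairwise distinct variables; $dom$ is its set of variables; $()$ is the empty environment; $\Gamma,x:U$ requires $x\notin dom(\Gamma)$; $env^M_\omega$ assigns $\omega$ to each variable of $FV(M)$ and nothing else; if $\Gamma_1=(x_i:U_i)_n,(y_j:V_j)_m$ and $\Gamma_2=(x_i:U'_i)_n,(z_k:W_k)_l$ with the $y_j$, $z_k$ all distinct, then $\Gamma_1\sqcap\Gamma_2=(x_i:U_i\sqcap U'_i)_n,(y_j:V_j)_m,(z_k:W_k)_l$. If $\Gamma=(x_i:U_i)_n$ and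 $\mathcal U=\{x_1,\dots,x_m\}$ with $m\ge n$, then $\Gamma{\uparrow^{\mathcal U}}=x_1:U_1,\dots,x_n:U_n,x_{n+1}:\omega,\dots,x_m:\omega$; when $dom(\Gamma)\subseteq FV(M)$, $\Gamma{\uparrow^M}$ means $\Gamma{\uparrow^{FV(M)}}$. Subtyping: $\sqsubseteq$ (on types, on environments, and on typings $\langle\Gamma\vdash U\rangle$) is the least relation closed under: $\Phi\sqsubseteq\Phi$; transitivity; $U_1\sqcap U_2\sqsubseteq U_1$; if $U_1\sqsubseteq V_1$ and $U_2\sqsubseteq V_2$ then $U_1\sqcap U_2\sqsubseteq V_1\sqcap V_2$; if $U_2\sqsubseteq U_1$ and $T_1\sqsubseteq T_2$ then $U_1\to T_1\sqsubseteq U_2\to T_2$; if $U_1\sqsubseteq U_2$ and $x\notin dom(\Gamma)$ then $\Gamma,x:U_1\sqsubseteq\Gamma,x:U_2$; if $U_1\sqsubseteq U_2$ and $\Gamma_2\sqsubseteq\Gamma_1$ then $\langle\Gamma_1\vdash U_1\rangle\sqsubseteq\langle\Gamma_2\vdash U_2\rangle$. Typing rules for $M:\langle\Gamma\vdash U\rangle$: (ax) $x:\langle x:T\vdash T\rangle$ for $T\in\mathbb T$; ($\omega$) $M:\langle env^M_\omega\vdash\omega\rangle$; ($\to_i$) from $M:\langle\Gamma,x:U\vdash T\rangle$ infer $\lambda x.M:\langle\Gamma\vdash U\to T\rangle$; ($\to'_i$) from $M:\langle\Gamma\vdash T\rangle$ and $x\notin dom(\Gamma)$ infer $\lambda x.M:\langle\Gamma\vdash\omega\to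 T\rangle$; ($\to_e$) from $M_1:\langle\Gamma_1\vdash U\to T\rangle$ and $M_2:\langle\Gamma_2\vdash U\rangle$ infer $M_1M_2:\langle\Gamma_1\sqcap\Gamma_2\vdash T\rangle$; ($\sqcap_i$) from $M:\langle\Gamma\vdash U_1\rangle$ and $M:\langle\Gamma\vdash U_2\rangle$ infer $M:\langle\Gamma\vdash U_1\sqcap U_2\rangle$; ($\sqsubseteq$) from $M:\langle\Gamma\vdash U\rangle$ and $\langle\Gamma\vdash U\rangle\sqsubseteq\langle\Gamma'\vdash U'\rangle$ infer $M:\langle\Gamma'\vdash U'\rangle$. -}

module Defs where

open import Data.Nat using (ℕ; zero; suc)
open import Data.Nat.Properties using (_≟_)
open import Data.Fin using (Fin; zero; suc)
open import Data.List using (List; []; _∷_; _++_)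
open import Data.List.Membership.DecPropositional _≟_ using (_∈_; _∉_; _∈?_)
open import Data.Maybe using (Maybe; just; nothing)
open import Data.Bool using (if_then_else_; true; false)
open import Relation.Nullary using (does)
open import Relation.Binary.PropositionalEquality using (_≡_)
open import Relation.Binary.Construct.Closure.ReflexiveTransitive using (Star)

-- Terms: well-scoped locally nameless representation.
-- Free variables are names (ℕ); bound variables are de Bruijn indices.
-- Tm 0 is exactly the set of λ-terms modulo α-conversion.

Var : Set
Var = ℕ

data Tm (n : ℕ) : Set where
  bv  : Fin n → Tm n
  fv  : Var → Tm n
  lam : Tm (suc n) → Tm n
  app : Tm n → Tm n → Tm n

-- the set of free variables FV(M) (as a list, possibly with repetitions)
FV : ∀ {n} → Tm n → List Var
FV (bv i)    = []
FV (fv x)    = x ∷ []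
FV (lam M)   = FV M
FV (app M N) = FV M ++ FV N

ext : ∀ {n m} → (Fin n → Fin m) → Fin (suc n) → Fin (suc m)
ext ρ zero    = zero
ext ρ (suc i) = suc (ρ i)

rename : ∀ {n m} → (Fin n → Fin m) → Tm n → Tm m
rename ρ (bv i)    = bv (ρ i)
rename ρ (fv x)    = fv x
rename ρ (lam M)   = lam (rename (ext ρ) M)
rename ρ (app M N) = app (rename ρ M) (rename ρ N)

exts : ∀ {n m} → (Fin n → Tm m) → Fin (suc n) → Tm (suc m)
exts σ zero    = bv zero
exts σ (suc i) = rename suc (σ i)

subst : ∀ {n m} → (Fin n → Tm m) → Tm n → Tm m
subst σ (bv i)    = σ i
subst σ (fv x)    = fv x
subst σ (lam M)   = lam (subst (exts σ) M)
subst σ (app M N) = app (subst σ M) (subst σ N)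

inst : ∀ {n} → Tm n → Fin (suc n) → Tm n
inst N zero    = N
inst N (suc i) = bv i

_[0:=_] : ∀ {n} → Tm (suc n) → Tm n → Tm n
M [0:= N ] = subst (inst N) M

-- opening a body with a (free) name x: for lam M this is the body of λx.(M^x)
open^ : Tm 1 → Var → Tm 0
open^ M x = M [0:= fv x ]

data _▷β_ {n : ℕ} : Tm n → Tm n → Set where
  beta : ∀ {M : Tm (suc n)} {N} → app (lam M) N ▷β (M [0:= N ])
  ξlam : ∀ {M M' : Tm (suc n)} → M ▷β M' → lam M ▷β lam M'
  ξappl : ∀ {M M' N} → M ▷β M' → app M N ▷β app M' N
  ξappr : ∀ {M N N'} → N ▷β N' → app M N ▷β app M N'

_▷β*_ : ∀ {n} → Tm n → Tm n → Set
_▷β*_ = Star _▷β_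

Atom : Set
Atom = ℕ

infixr 7 _⇒_
infixl 8 _⊓_

mutual
  data Ty : Set where
    atom : Atom → Ty
    _⇒_  : UTy → Ty → Ty

  data UTy : Set where
    ω   : UTy
    _⊓_ : UTy → UTy → UTy
    ⌜_⌝ : Ty → UTy

-- The quotient by comm./assoc./idempotence of ⊓ and ω ⊓ U = U,
-- presented as the generated congruence.
infix 4 _≈_
data _≈_ : UTy → UTy → Set where
  ≈-refl  : ∀ {U} → U ≈ U
  ≈-sym   : ∀ {U V} → U ≈ V → V ≈ U
  ≈-trans : ∀ {U V W} → U ≈ V → V ≈ W → U ≈ W
  ⊓-comm  : ∀ {U V} → U ⊓ V ≈ V ⊓ U
  ⊓-assoc : ∀ {U V W} → (U ⊓ V) ⊓ W ≈ U ⊓ (V ⊓ W)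
  ⊓-idem  : ∀ {U} → U ⊓ U ≈ U
  ω-unit  : ∀ {U} → ω ⊓ U ≈ U
  ⊓-cong  : ∀ {U U' V V'} → U ≈ U' → V ≈ V' → U ⊓ V ≈ U' ⊓ V'
  ⇒-cong  : ∀ {U U' T T'} → U ≈ U' → ⌜ T ⌝ ≈ ⌜ T' ⌝ → ⌜ U ⇒ T ⌝ ≈ ⌜ U' ⇒ T' ⌝

infix 4 _⊑_
data _⊑_ : UTy → UTy → Set where
  ⊑-≈     : ∀ {U V} → U ≈ V → U ⊑ V
  ⊑-trans : ∀ {U V W} → U ⊑ V → V ⊑ W → U ⊑ W
  ⊑-⊓ˡ    : ∀ {U₁ U₂} → U₁ ⊓ U₂ ⊑ U₁
  ⊑-⊓     : ∀ {U₁ U₂ V₁ V₂} → U₁ ⊑ V₁ → U₂ ⊑ V₂ → U₁ ⊓ U₂ ⊑ V₁ ⊓ V₂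
  ⊑-⇒     : ∀ {U₁ U₂ T₁ T₂} → U₂ ⊑ U₁ → ⌜ T₁ ⌝ ⊑ ⌜ T₂ ⌝ → ⌜ U₁ ⇒ T₁ ⌝ ⊑ ⌜ U₂ ⇒ T₂ ⌝

Env : Set
Env = Var → Maybe UTy

_∉dom_ : Var → Env → Set
x ∉dom Γ = Γ x ≡ nothing

[_∶_] : Var → UTy → Env
[ x ∶ U ] y = if does (y ≟ x) then just U else nothing

-- Γ , x : U   (used only under the side condition x ∉ dom Γ)
_,_∶_ : Env → Var → UTy → Env
(Γ , x ∶ U) y = if does (y ≟ x) then just U else Γ y

envω : Tm 0 → Env
envω M y = if does (y ∈? FV M) then just ω else nothing

_⊓ᵉ_ : Env → Env → Env
(Γ₁ ⊓ᵉ Γ₂) y with Γ₁ y | Γ₂ y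
... | just U  | just V  = just (U ⊓ V)
... | just U  | nothing = just U
... | nothing | just V  = just V
... | nothing | nothing = nothing

_↑_ : Env → Tm 0 → Env
(Γ ↑ M) y with Γ y | does (y ∈? FV M)
... | just U  | _     = just U
... | nothing | true  = just ω
... | nothing | false = nothing

-- subtyping on environments: same domain, pointwise ⊑
-- (this is exactly the relation generated by reflexivity, transitivity
--  and  Γ,x:U₁ ⊑ Γ,x:U₂  for U₁ ⊑ U₂)
data _⊑ᵐ_ : Maybe UTy → Maybe UTy → Set where
  nothing : nothing ⊑ᵐ nothing
  just    : ∀ {U V} → U ⊑ V → just U ⊑ᵐ just V

_⊑ᵉ_ : Env → Env → Set
Γ ⊑ᵉ Γ' = ∀ x → Γ x ⊑ᵐ Γ' x

record Typing : Set where
  constructor ⟨_⊢_⟩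
  field
    env : Env
    ty  : UTy

data _⊑ᵗ_ : Typing → Typing → Set where
  ⊑-typing : ∀ {Γ₁ Γ₂ U₁ U₂} → U₁ ⊑ U₂ → Γ₂ ⊑ᵉ Γ₁ → ⟨ Γ₁ ⊢ U₁ ⟩ ⊑ᵗ ⟨ Γ₂ ⊢ U₂ ⟩

infix 3 _∶_
data _∶_ : Tm 0 → Typing → Set where
  ax   : ∀ {x T} → fv x ∶ ⟨ [ x ∶ ⌜ T ⌝ ] ⊢ ⌜ T ⌝ ⟩
  ωr   : ∀ {M} → M ∶ ⟨ envω M ⊢ ω ⟩
  →i   : ∀ {M : Tm 1} {x Γ U T} → x ∉ FV M → x ∉dom Γ →
         open^ M x ∶ ⟨ (Γ , x ∶ U) ⊢ ⌜ T ⌝ ⟩ →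
         lam M ∶ ⟨ Γ ⊢ ⌜ U ⇒ T ⌝ ⟩
  →'i  : ∀ {M : Tm 1} {x Γ T} → x ∉ FV M →
         open^ M x ∶ ⟨ Γ ⊢ ⌜ T ⌝ ⟩ → x ∉dom Γ →
         lam M ∶ ⟨ Γ ⊢ ⌜ ω ⇒ T ⌝ ⟩
  →e   : ∀ {M₁ M₂ Γ₁ Γ₂ U T} → M₁ ∶ ⟨ Γ₁ ⊢ ⌜ U ⇒ T ⌝ ⟩ → M₂ ∶ ⟨ Γ₂ ⊢ U ⟩ →
         app M₁ M₂ ∶ ⟨ Γ₁ ⊓ᵉ Γ₂ ⊢ ⌜ T ⌝ ⟩
  ⊓i   : ∀ {M Γ U₁ U₂} → M ∶ ⟨ Γ ⊢ U₁ ⟩ → M ∶ ⟨ Γ ⊢ U₂ ⟩ → M ∶ ⟨ Γ ⊢ U₁ ⊓ U₂ ⟩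
  ⊑r   : ∀ {M Φ Φ'} → M ∶ Φ → Φ ⊑ᵗ Φ' → M ∶ Φ'

-- Call X an expansion of Y (Expands X Y) when every typing of Y is a typing of X in
-- the environment extended by ω on the free variables of X.  Expansion is reflexive
-- and transitive, so the corollary follows along ▷β* from one-step expansion, which
-- is proved by induction on the reduction (for open terms under a closing
-- substitution, since reduction may happen below binders).  The ω-, ⊓- and
-- subsumption rules commute with expansion, so only derivations ending in a
-- syntax-directed rule need treatment.  The redex case inverts the substitution
-- lemma: a typing of P[0:=N] splits into a typing of the body P at a fresh name x
-- and a typing of N at the type that x receives.  Below a λ, the body's derivation
-- is first moved to a fresh name by swapping names, which preserves typing.
-- Throughout, a derivation of M declares exactly the free variables of M, so two
-- environments of the same term are compared pointwise, reading absent entries as ω.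

module Submission where

open import Data.Bool using (true; false; if_then_else_)
open import Data.Empty using (⊥; ⊥-elim)
open import Data.Fin using (Fin; zero; suc)
open import Data.List using (List; []; _∷_; _++_; map)
open import Data.List.Membership.Propositional using (_∈_; _∉_)
open import Data.List.Membership.Propositional.Properties using (∈-++⁺ˡ; ∈-++⁺ʳ; ∈-++⁻; ∈-map⁺; ∈-map⁻)
open import Data.List.Properties using (map-++)
open import Data.List.Relation.Binary.Subset.Propositional using (_⊆_)
open import Data.List.Relation.Binary.Subset.Propositional.Properties using (++⁺)
open import Data.List.Relation.Unary.Any using (here; there)
open import Data.Maybe using (Maybe; just; nothing)
open import Data.Nat using (suc; _≤_)
open import Data.Nat.ListAction using (sum)
open import Data.Nat.Properties using (_≟_; ≤-trans; m≤m+n; m≤n+m; 1+n≰n)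
open import Data.List.Membership.DecPropositional _≟_ using (_∈?_)
open import Data.Product using (Σ; ∃; _×_; proj₁; proj₂) renaming (_,_ to _,,_)
open import Data.Sum using (_⊎_; inj₁; inj₂; [_,_]′)
open import Data.Unit using (⊤)
open import Function using (_∘_)
open import Relation.Binary.Construct.Closure.ReflexiveTransitive using (ε; _◅_)
open import Relation.Binary.PropositionalEquality
  using (_≡_; _≢_; _≗_; refl; sym; trans; cong; cong₂) renaming (subst to transport)
open import Relation.Nullary using (Dec; yes; no; does; ¬_)

open import Defs

-- Substitution algebra

ext-cong : ∀ {n m} {ρ ρ' : Fin n → Fin m} → ρ ≗ ρ' → ext ρ ≗ ext ρ'
ext-cong e zero    = refl
ext-cong e (suc i) = cong suc (e i)

rename-cong : ∀ {n m} {ρ ρ' : Fin n → Fin m} → ρ ≗ ρ' → ∀ M → rename ρ M ≡ rename ρ' M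
rename-cong e (bv i)    = cong bv (e i)
rename-cong e (fv x)    = refl
rename-cong e (lam M)   = cong lam (rename-cong (ext-cong e) M)
rename-cong e (app M N) = cong₂ app (rename-cong e M) (rename-cong e N)

exts-cong : ∀ {n m} {σ σ' : Fin n → Tm m} → σ ≗ σ' → exts σ ≗ exts σ'
exts-cong e zero    = refl
exts-cong e (suc i) = cong (rename suc) (e i)

subst-cong : ∀ {n m} {σ σ' : Fin n → Tm m} → σ ≗ σ' → ∀ M → subst σ M ≡ subst σ' M
subst-cong e (bv i)    = e i
subst-cong e (fv x)    = refl
subst-cong e (lam M)   = cong lam (subst-cong (exts-cong e) M)
subst-cong e (app M N) = cong₂ app (subst-cong e M) (subst-cong e N)

rename-rename : ∀ {n m k} (ρ : Fin m → Fin k) (ρ' : Fin n → Fin m) M →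
  rename ρ (rename ρ' M) ≡ rename (λ i → ρ (ρ' i)) M
rename-rename ρ ρ' (bv i)    = refl
rename-rename ρ ρ' (fv x)    = refl
rename-rename ρ ρ' (lam M)   = cong lam (trans (rename-rename (ext ρ) (ext ρ') M)
  (rename-cong (λ { zero → refl ; (suc i) → refl }) M))
rename-rename ρ ρ' (app M N) = cong₂ app (rename-rename ρ ρ' M) (rename-rename ρ ρ' N)

subst-rename : ∀ {n m k} (σ : Fin m → Tm k) (ρ : Fin n → Fin m) M →
  subst σ (rename ρ M) ≡ subst (λ i → σ (ρ i)) M
subst-rename σ ρ (bv i)    = refl
subst-rename σ ρ (fv x)    = refl
subst-rename σ ρ (lam M)   = cong lam (trans (subst-rename (exts σ) (ext ρ) M)
  (subst-cong (λ { zero → refl ; (suc i) → refl }) M))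
subst-rename σ ρ (app M N) = cong₂ app (subst-rename σ ρ M) (subst-rename σ ρ N)

rename-subst : ∀ {n m k} (ρ : Fin m → Fin k) (σ : Fin n → Tm m) M →
  rename ρ (subst σ M) ≡ subst (λ i → rename ρ (σ i)) M
rename-subst ρ σ (bv i)    = refl
rename-subst ρ σ (fv x)    = refl
rename-subst ρ σ (lam M)   = cong lam (trans (rename-subst (ext ρ) (exts σ) M)
  (subst-cong (λ { zero → refl
                 ; (suc i) → trans (rename-rename (ext ρ) suc (σ i)) (sym (rename-rename suc ρ (σ i))) }) M))
rename-subst ρ σ (app M N) = cong₂ app (rename-subst ρ σ M) (rename-subst ρ σ N)

subst-subst : ∀ {n m k} (σ : Fin m → Tm k) (τ : Fin n → Tm m) M →
  subst σ (subst τ M) ≡ subst (λ i → subst σ (τ i)) M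
subst-subst σ τ (bv i)    = refl
subst-subst σ τ (fv x)    = refl
subst-subst σ τ (lam M)   = cong lam (trans (subst-subst (exts σ) (exts τ) M)
  (subst-cong (λ { zero → refl
                 ; (suc i) → trans (subst-rename (exts σ) suc (τ i)) (sym (rename-subst suc σ (τ i))) }) M))
subst-subst σ τ (app M N) = cong₂ app (subst-subst σ τ M) (subst-subst σ τ N)

subst-id : ∀ {n} {σ : Fin n → Tm n} → σ ≗ bv → ∀ M → subst σ M ≡ M
subst-id e (bv i)    = e i
subst-id e (fv x)    = refl
subst-id e (lam M)   = cong lam (subst-id (λ { zero → refl ; (suc i) → cong (rename suc) (e i) }) M)
subst-id e (app M N) = cong₂ app (subst-id e M) (subst-id e N)

subst-closed : ∀ (M : Tm 0) → subst (λ ()) M ≡ M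
subst-closed M = subst-id (λ ()) M

inst-weaken : ∀ {n} (K T : Tm n) → subst (inst K) (rename suc T) ≡ T
inst-weaken K T = trans (subst-rename (inst K) suc T) (subst-id (λ i → refl) T)

infixr 5 _∷ₛ_
_∷ₛ_ : ∀ {n m} → Tm m → (Fin n → Tm m) → Fin (suc n) → Tm m
(t ∷ₛ σ) zero    = t
(t ∷ₛ σ) (suc i) = σ i

subst-inst : ∀ {n m} (σ : Fin n → Tm m) (M : Tm (suc n)) N →
  subst σ (M [0:= N ]) ≡ (subst (exts σ) M) [0:= subst σ N ]
subst-inst σ M N = trans (subst-subst σ (inst N) M) (sym (trans (subst-subst (inst (subst σ N)) (exts σ) M)
  (subst-cong (λ { zero → refl ; (suc i) → inst-weaken (subst σ N) (σ i) }) M)))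

open-exts : ∀ {n} (σ : Fin n → Tm 0) (M : Tm (suc n)) z →
  open^ (subst (exts σ) M) z ≡ subst (fv z ∷ₛ σ) M
open-exts σ M z = trans (subst-subst (inst (fv z)) (exts σ) M)
  (subst-cong (λ { zero → refl ; (suc i) → inst-weaken (fv z) (σ i) }) M)

-- For the body P' of a λ inside a context P = λ.P' with one hole (index 1 in P'),
-- openInner P' y opens the λ-binder with the name y, keeping the hole.
openInner : Tm 2 → Var → Tm 1
openInner P' y = subst (fv y ∷ₛ bv) P'

inst-openInner : ∀ (K : Tm 0) y (P' : Tm 2) →
  openInner P' y [0:= K ] ≡ subst (fv y ∷ₛ inst K) P'
inst-openInner K y P' = trans (subst-subst (inst K) (fv y ∷ₛ bv) P')
  (subst-cong (λ { zero → refl ; (suc i) → refl }) P')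

openInner-open : ∀ (K : Tm 0) y (P' : Tm 2) →
  openInner P' y [0:= K ] ≡ open^ (subst (exts (inst K)) P') y
openInner-open K y P' = trans (inst-openInner K y P') (sym (open-exts (inst K) P' y))

-- Free variables

FV-rename : ∀ {n m} (ρ : Fin n → Fin m) M → FV (rename ρ M) ≡ FV M
FV-rename ρ (bv i)    = refl
FV-rename ρ (fv x)    = refl
FV-rename ρ (lam M)   = FV-rename (ext ρ) M
FV-rename ρ (app M N) = cong₂ _++_ (FV-rename ρ M) (FV-rename ρ N)

FV-subst⁺ : ∀ {n m} (σ : Fin n → Tm m) M → FV M ⊆ FV (subst σ M)
FV-subst⁺ σ (fv y)    p = p
FV-subst⁺ σ (lam M)   p = FV-subst⁺ (exts σ) M p
FV-subst⁺ σ (app M N) p = ++⁺ (FV-subst⁺ σ M) (FV-subst⁺ σ N) p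

Uses : ∀ {n} → Tm n → Fin n → Set
Uses {n} M i = ∀ {k} (τ : Fin n → Tm k) → FV (τ i) ⊆ FV (subst τ M)

FV-subst⁻ : ∀ {n m} (σ : Fin n → Tm m) M {x} → x ∈ FV (subst σ M) →
  x ∈ FV M ⊎ Σ (Fin n) (λ i → Uses M i × x ∈ FV (σ i))
FV-subst⁻ σ (bv i) p = inj₂ (i ,, (λ τ q → q) ,, p)
FV-subst⁻ σ (fv y) p = inj₁ p
FV-subst⁻ σ (lam M) p with FV-subst⁻ (exts σ) M p
... | inj₁ q                 = inj₁ q
... | inj₂ (zero ,, _ ,, ())
... | inj₂ (suc i ,, u ,, q) =
  inj₂ (i ,, (λ τ r → u (exts τ) (transport (_ ∈_) (sym (FV-rename suc (τ i))) r))
          ,, transport (_ ∈_) (FV-rename suc (σ i)) q)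
FV-subst⁻ σ (app M N) p with ∈-++⁻ (FV (subst σ M)) p
... | inj₁ q with FV-subst⁻ σ M q
...   | inj₁ r            = inj₁ (∈-++⁺ˡ r)
...   | inj₂ (i ,, u ,, r) = inj₂ (i ,, (λ τ s → ∈-++⁺ˡ (u τ s)) ,, r)
FV-subst⁻ σ (app M N) p | inj₂ q with FV-subst⁻ σ N q
...   | inj₁ r            = inj₁ (∈-++⁺ʳ (FV M) r)
...   | inj₂ (i ,, u ,, r) = inj₂ (i ,, (λ τ s → ∈-++⁺ʳ (FV (subst τ M)) (u τ s)) ,, r)

FV-open⁻ : ∀ (M : Tm 1) x {y} → y ∈ FV (open^ M x) → y ≢ x → y ∈ FV M
FV-open⁻ M x p y≢x with FV-subst⁻ (inst (fv x)) M p
... | inj₁ q                       = q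
... | inj₂ (zero ,, _ ,, here y≡x) = ⊥-elim (y≢x y≡x)

FV-inst⁻ : ∀ {m} (P : Tm (suc m)) N → FV (P [0:= N ]) ⊆ FV P ++ FV N
FV-inst⁻ P N p with FV-subst⁻ (inst N) P p
... | inj₁ q                = ∈-++⁺ˡ q
... | inj₂ (zero ,, _ ,, q) = ∈-++⁺ʳ (FV P) q
... | inj₂ (suc i ,, _ ,, ())

-- β-reduction creates no free variables (stated under a substitution, as needed
-- for reductions below binders).
FV-reduce : ∀ {n m} {M M' : Tm n} → M ▷β M' → ∀ (σ : Fin n → Tm m) → FV (subst σ M') ⊆ FV (subst σ M)
FV-reduce (beta {M = P} {N}) σ p =
  FV-inst⁻ (subst (exts σ) P) (subst σ N) (transport (λ t → _ ∈ FV t) (subst-inst σ P N) p)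
FV-reduce (ξlam r)  σ p = FV-reduce r (exts σ) p
FV-reduce (ξappl r) σ p = ++⁺ (FV-reduce r σ) (λ q → q) p
FV-reduce (ξappr r) σ p = ++⁺ (λ q → q) (FV-reduce r σ) p

FV-reduce₀ : ∀ {M M' : Tm 0} → M ▷β M' → FV M' ⊆ FV M
FV-reduce₀ {M} {M'} r p = transport (λ t → _ ∈ FV t) (subst-closed M)
  (FV-reduce r (λ ()) (transport (λ t → _ ∈ FV t) (sym (subst-closed M')) p))

fresh : (xs : List Var) → ∃ λ x → x ∉ xs
fresh xs = suc (sum xs) ,, λ p → 1+n≰n (≤sum p)
  where
  ≤sum : ∀ {x xs} → x ∈ xs → x ≤ sum xs
  ≤sum {xs = y ∷ ys} (here refl) = m≤m+n y (sum ys)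
  ≤sum {xs = y ∷ ys} (there p)   = ≤-trans (≤sum p) (m≤n+m (sum ys) y)

-- Swapping two names a and b

module Swap (a b : Var) where

  -- opaque, so that goals mention sw rather than its case analysis
  opaque
    sw : Var → Var
    sw x with x ≟ a
    ... | yes _ = b
    ... | no _ with x ≟ b
    ...   | yes _ = a
    ...   | no _  = x

    sw-a : sw a ≡ b
    sw-a with a ≟ a
    ... | yes _ = refl
    ... | no a≢a = ⊥-elim (a≢a refl)

    sw-b : sw b ≡ a
    sw-b with b ≟ a
    ... | yes b≡a = b≡a
    ... | no _ with b ≟ b
    ...   | yes _ = refl
    ...   | no b≢b = ⊥-elim (b≢b refl)

    sw-other : ∀ {x} → x ≢ a → x ≢ b → sw x ≡ x
    sw-other {x} x≢a x≢b with x ≟ a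
    ... | yes x≡a = ⊥-elim (x≢a x≡a)
    ... | no _ with x ≟ b
    ...   | yes x≡b = ⊥-elim (x≢b x≡b)
    ...   | no _ = refl

    sw-involutive : ∀ x → sw (sw x) ≡ x
    sw-involutive x with x ≟ a
    ... | yes refl = sw-b
    ... | no x≢a with x ≟ b
    ...   | yes refl = sw-a
    ...   | no x≢b = sw-other x≢a x≢b

  sw-invariant : ∀ {A : Set} (f : Var → A) → f a ≡ f b → ∀ x → f x ≡ f (sw x)
  sw-invariant f fa≡fb x with x ≟ a | x ≟ b
  ... | yes refl | _        = trans fa≡fb (cong f (sym sw-a))
  ... | no _     | yes refl = trans (sym fa≡fb) (cong f (sym sw-b))
  ... | no x≢a   | no x≢b   = cong f (sym (sw-other x≢a x≢b))

  sw-transpose : ∀ {x y} → sw x ≡ y → x ≡ sw y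
  sw-transpose {x} refl = sym (sw-involutive x)

  swT : ∀ {n} → Tm n → Tm n
  swT (bv i)    = bv i
  swT (fv x)    = fv (sw x)
  swT (lam M)   = lam (swT M)
  swT (app M N) = app (swT M) (swT N)

  swT-rename : ∀ {n m} (ρ : Fin n → Fin m) M → swT (rename ρ M) ≡ rename ρ (swT M)
  swT-rename ρ (bv i)    = refl
  swT-rename ρ (fv x)    = refl
  swT-rename ρ (lam M)   = cong lam (swT-rename (ext ρ) M)
  swT-rename ρ (app M N) = cong₂ app (swT-rename ρ M) (swT-rename ρ N)

  swT-subst : ∀ {n m} (σ : Fin n → Tm m) M → swT (subst σ M) ≡ subst (λ i → swT (σ i)) (swT M)
  swT-subst σ (bv i)    = refl
  swT-subst σ (fv x)    = refl
  swT-subst σ (lam M)   = cong lam (trans (swT-subst (exts σ) M)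
    (subst-cong (λ { zero → refl ; (suc i) → swT-rename suc (σ i) }) (swT M)))
  swT-subst σ (app M N) = cong₂ app (swT-subst σ M) (swT-subst σ N)

  swT-open : ∀ (M : Tm 1) x → swT (open^ M x) ≡ open^ (swT M) (sw x)
  swT-open M x = trans (swT-subst (inst (fv x)) M) (subst-cong (λ { zero → refl ; (suc ()) }) (swT M))

  FV-swT : ∀ {n} (M : Tm n) → FV (swT M) ≡ map sw (FV M)
  FV-swT (bv i)    = refl
  FV-swT (fv x)    = refl
  FV-swT (lam M)   = FV-swT M
  FV-swT (app M N) = trans (cong₂ _++_ (FV-swT M) (FV-swT N)) (sym (map-++ sw (FV M) (FV N)))

  ∈-swT⁺ : ∀ {n} (M : Tm n) {y} → y ∈ FV M → sw y ∈ FV (swT M)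
  ∈-swT⁺ M p = transport (_ ∈_) (sym (FV-swT M)) (∈-map⁺ sw p)

  ∈-swT⁻ : ∀ {n} (M : Tm n) {y} → y ∈ FV (swT M) → sw y ∈ FV M
  ∈-swT⁻ M p with ∈-map⁻ sw (transport (_ ∈_) (FV-swT M) p)
  ... | z ,, z∈M ,, refl = transport (_∈ FV M) (sym (sw-involutive z)) z∈M

  swT-fresh : ∀ {n} (M : Tm n) → a ∉ FV M → b ∉ FV M → swT M ≡ M
  swT-fresh (bv i)    _   _   = refl
  swT-fresh (fv x)    a∉M b∉M = cong fv (sw-other (λ e → a∉M (here (sym e))) (λ e → b∉M (here (sym e))))
  swT-fresh (lam M)   a∉M b∉M = cong lam (swT-fresh M a∉M b∉M)
  swT-fresh (app M N) a∉M b∉M =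
    cong₂ app (swT-fresh M (a∉M ∘ ∈-++⁺ˡ) (b∉M ∘ ∈-++⁺ˡ)) (swT-fresh N (a∉M ∘ ∈-++⁺ʳ _) (b∉M ∘ ∈-++⁺ʳ _))

-- Subtyping: ⊓ is a greatest lower bound and ω the top element

⊑-refl : ∀ {U} → U ⊑ U
⊑-refl = ⊑-≈ ≈-refl

≡⇒⊑ : ∀ {U V} → U ≡ V → U ⊑ V
≡⇒⊑ refl = ⊑-refl

infixr 2 _⟫_
_⟫_ : ∀ {U V W} → U ⊑ V → V ⊑ W → U ⊑ W
_⟫_ = ⊑-trans

⊑-ω : ∀ {U} → U ⊑ ω
⊑-ω = ⊑-≈ (≈-sym ω-unit) ⟫ ⊑-⊓ˡ

⊑-⊓ʳ : ∀ {U V} → U ⊓ V ⊑ V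
⊑-⊓ʳ = ⊑-≈ ⊓-comm ⟫ ⊑-⊓ˡ

⊑-glb : ∀ {W U V} → W ⊑ U → W ⊑ V → W ⊑ U ⊓ V
⊑-glb p q = ⊑-≈ (≈-sym ⊓-idem) ⟫ ⊑-⊓ p q

⊓-interchange : ∀ {U₁ U₂ V₁ V₂} → (U₁ ⊓ U₂) ⊓ (V₁ ⊓ V₂) ⊑ (U₁ ⊓ V₁) ⊓ (U₂ ⊓ V₂)
⊓-interchange = ⊑-glb (⊑-⊓ ⊑-⊓ˡ ⊑-⊓ˡ) (⊑-⊓ ⊑-⊓ʳ ⊑-⊓ʳ)

-- Environments, read totally: an undeclared variable has type ω

orω : Maybe UTy → UTy
orω nothing  = ω
orω (just U) = U

_⊓ᵐ_ : Maybe UTy → Maybe UTy → Maybe UTy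
just U  ⊓ᵐ just V  = just (U ⊓ V)
just U  ⊓ᵐ nothing = just U
nothing ⊓ᵐ just V  = just V
nothing ⊓ᵐ nothing = nothing

⊓ᵉ-at : ∀ Γ₁ Γ₂ y → (Γ₁ ⊓ᵉ Γ₂) y ≡ Γ₁ y ⊓ᵐ Γ₂ y
⊓ᵉ-at Γ₁ Γ₂ y with Γ₁ y | Γ₂ y
... | just U  | just V  = refl
... | just U  | nothing = refl
... | nothing | just V  = refl
... | nothing | nothing = refl

orω-⊓ᵐ : ∀ m m' → orω (m ⊓ᵐ m') ≈ orω m ⊓ orω m'
orω-⊓ᵐ (just U) (just V) = ≈-refl
orω-⊓ᵐ (just U) nothing  = ≈-sym (≈-trans ⊓-comm ω-unit)
orω-⊓ᵐ nothing  (just V) = ≈-sym ω-unit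
orω-⊓ᵐ nothing  nothing  = ≈-sym ⊓-idem

orω-⊓ᵉ : ∀ Γ₁ Γ₂ y → orω ((Γ₁ ⊓ᵉ Γ₂) y) ≈ orω (Γ₁ y) ⊓ orω (Γ₂ y)
orω-⊓ᵉ Γ₁ Γ₂ y = transport (λ m → orω m ≈ orω (Γ₁ y) ⊓ orω (Γ₂ y)) (sym (⊓ᵉ-at Γ₁ Γ₂ y)) (orω-⊓ᵐ (Γ₁ y) (Γ₂ y))

⊓ᵐ-nothing⁻ : ∀ m m' → m ⊓ᵐ m' ≡ nothing → m ≡ nothing × m' ≡ nothing
⊓ᵐ-nothing⁻ nothing nothing _ = refl ,, refl
⊓ᵐ-nothing⁻ (just _) (just _) ()
⊓ᵐ-nothing⁻ (just _) nothing  ()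
⊓ᵐ-nothing⁻ nothing  (just _) ()

⊓ᵉ-nothing⁺ : ∀ Γ₁ Γ₂ {y} → Γ₁ y ≡ nothing → Γ₂ y ≡ nothing → (Γ₁ ⊓ᵉ Γ₂) y ≡ nothing
⊓ᵉ-nothing⁺ Γ₁ Γ₂ {y} e₁ e₂ rewrite ⊓ᵉ-at Γ₁ Γ₂ y | e₁ | e₂ = refl

if-yes : ∀ {P : Set} {A : Set} (d : Dec P) {a b : A} → P → (if does d then a else b) ≡ a
if-yes (yes _) p = refl
if-yes (no ¬p) p = ⊥-elim (¬p p)

if-no : ∀ {P : Set} {A : Set} (d : Dec P) {a b : A} → ¬ P → (if does d then a else b) ≡ b
if-no (yes p) ¬p = ⊥-elim (¬p p)
if-no (no _)  ¬p = refl

[]-here : ∀ x U → [ x ∶ U ] x ≡ just U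
[]-here x U = if-yes (x ≟ x) refl

[]-there : ∀ {x y} U → y ≢ x → [ x ∶ U ] y ≡ nothing
[]-there {x} {y} U = if-no (y ≟ x)

,-here : ∀ Γ x U → (Γ , x ∶ U) x ≡ just U
,-here Γ x U = if-yes (x ≟ x) refl

,-there : ∀ Γ {x y} U → y ≢ x → (Γ , x ∶ U) y ≡ Γ y
,-there Γ {x} {y} U = if-no (y ≟ x)

envω-in : ∀ M {y} → y ∈ FV M → envω M y ≡ just ω
envω-in M {y} y∈M with y ∈? FV M
... | yes _   = refl
... | no y∉M = ⊥-elim (y∉M y∈M)

envω-out : ∀ M {y} → y ∉ FV M → envω M y ≡ nothing
envω-out M {y} y∉M with y ∈? FV M
... | yes y∈M = ⊥-elim (y∉M y∈M)
... | no _    = refl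

orω-envω : ∀ M y → orω (envω M y) ≡ ω
orω-envω M y with y ∈? FV M
... | yes _ = refl
... | no _  = refl

-- Γ ↑ M only adds ω-declarations, so read totally it is Γ itself.
orω-↑ : ∀ Γ M y → orω ((Γ ↑ M) y) ≡ orω (Γ y)
orω-↑ Γ M y with Γ y | does (y ∈? FV M)
... | just U  | _     = refl
... | nothing | true  = refl
... | nothing | false = refl

↑-nothing⁺ : ∀ Γ M {y} → y ∉ FV M → Γ y ≡ nothing → (Γ ↑ M) y ≡ nothing
↑-nothing⁺ Γ M {y} y∉M Γy with Γ y | y ∈? FV M
... | nothing | yes y∈M = ⊥-elim (y∉M y∈M)
... | nothing | no _    = refl

↑-nothing⁻ : ∀ Γ M {y} → (Γ ↑ M) y ≡ nothing → y ∉ FV M × Γ y ≡ nothing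
↑-nothing⁻ Γ M {y} e with Γ y | y ∈? FV M | e
... | just U  | _       | ()
... | nothing | yes _   | ()
... | nothing | no y∉M | _ = y∉M ,, refl

↑-cong : ∀ {Γ Γ' M M' y} → Γ y ≡ Γ' y → (y ∈ FV M → y ∈ FV M') → (y ∈ FV M' → y ∈ FV M) →
  (Γ ↑ M) y ≡ (Γ' ↑ M') y
↑-cong {Γ} {Γ'} {M} {M'} {y} e to from with Γ y | Γ' y | e | y ∈? FV M | y ∈? FV M'
... | just U  | just .U | refl | _       | _        = refl
... | nothing | nothing | refl | yes _   | yes _    = refl
... | nothing | nothing | refl | no _    | no _     = refl
... | nothing | nothing | refl | yes y∈M | no y∉M' = ⊥-elim (y∉M' (to y∈M))
... | nothing | nothing | refl | no y∉M  | yes y∈M' = ⊥-elim (y∉M (from y∈M'))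

_∖_ : Env → Var → Env
(Γ ∖ x) y = if does (y ≟ x) then nothing else Γ y

∖-here : ∀ Γ x → (Γ ∖ x) x ≡ nothing
∖-here Γ x = if-yes (x ≟ x) refl

∖-there : ∀ Γ {x y} → y ≢ x → (Γ ∖ x) y ≡ Γ y
∖-there Γ {x} {y} = if-no (y ≟ x)

-- The domain invariant: a derivation of M : ⟨Γ ⊢ U⟩ declares exactly FV(M)

record Dom (Γ : Env) (M : Tm 0) : Set where
  constructor mkDom
  field
    undeclared⇒∉ : ∀ {y} → Γ y ≡ nothing → y ∉ FV M
    ∉⇒undeclared : ∀ {y} → y ∉ FV M → Γ y ≡ nothing
open Dom public

just≢nothing : ∀ {U : UTy} → just U ≢ nothing
just≢nothing ()

Dom-[] : ∀ x U → Dom [ x ∶ U ] (fv x)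
Dom-[] x U = mkDom (λ { e (here refl) → just≢nothing (trans (sym ([]-here x U)) e) })
                   (λ y∉x → []-there U (y∉x ∘ here))

Dom-envω : ∀ M → Dom (envω M) M
Dom-envω M = mkDom (λ e y∈M → just≢nothing (trans (sym (envω-in M y∈M)) e)) (envω-out M)

Dom-lam : ∀ {M : Tm 1} {x Γ Δ} → Dom Δ (open^ M x) → x ∉ FV M → Γ x ≡ nothing →
  (∀ {y} → y ≢ x → Δ y ≡ Γ y) → Dom Γ (lam M)
Dom-lam {M} {x} {Γ} {Δ} d x∉M Γx Δ≡Γ = mkDom undeclared ∉M
  where
  undeclared : ∀ {y} → Γ y ≡ nothing → y ∉ FV M
  undeclared {y} Γy y∈M with y ≟ x
  ... | yes refl = x∉M y∈M
  ... | no y≢x   = undeclared⇒∉ d (trans (Δ≡Γ y≢x) Γy) (FV-subst⁺ (inst (fv x)) M y∈M)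
  ∉M : ∀ {y} → y ∉ FV M → Γ y ≡ nothing
  ∉M {y} y∉M with y ≟ x
  ... | yes refl = Γx
  ... | no y≢x   = trans (sym (Δ≡Γ y≢x)) (∉⇒undeclared d (λ p → y∉M (FV-open⁻ M x p y≢x)))

Dom-app : ∀ {M₁ M₂ Γ₁ Γ₂} → Dom Γ₁ M₁ → Dom Γ₂ M₂ → Dom (Γ₁ ⊓ᵉ Γ₂) (app M₁ M₂)
Dom-app {M₁} {M₂} {Γ₁} {Γ₂} d₁ d₂ = mkDom undeclared ∉M
  where
  undeclared : ∀ {y} → (Γ₁ ⊓ᵉ Γ₂) y ≡ nothing → y ∉ FV M₁ ++ FV M₂
  undeclared {y} e p with ⊓ᵐ-nothing⁻ (Γ₁ y) (Γ₂ y) (trans (sym (⊓ᵉ-at Γ₁ Γ₂ y)) e)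
  ... | e₁ ,, e₂ = [ undeclared⇒∉ d₁ e₁ , undeclared⇒∉ d₂ e₂ ]′ (∈-++⁻ (FV M₁) p)
  ∉M : ∀ {y} → y ∉ FV M₁ ++ FV M₂ → (Γ₁ ⊓ᵉ Γ₂) y ≡ nothing
  ∉M y∉ = ⊓ᵉ-nothing⁺ Γ₁ Γ₂ (∉⇒undeclared d₁ (y∉ ∘ ∈-++⁺ˡ)) (∉⇒undeclared d₂ (y∉ ∘ ∈-++⁺ʳ (FV M₁)))

Dom-⊑ᵉ : ∀ {Γ Δ M} → Δ ⊑ᵉ Γ → Dom Γ M → Dom Δ M
Dom-⊑ᵉ {Γ} {Δ} Δ⊑Γ d = mkDom (λ {y} e → undeclared⇒∉ d (to (Δ⊑Γ y) e))
                             (λ {y} y∉ → from (Δ⊑Γ y) (∉⇒undeclared d y∉))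
  where
  to : ∀ {m m'} → m ⊑ᵐ m' → m ≡ nothing → m' ≡ nothing
  to nothing e = e
  from : ∀ {m m'} → m ⊑ᵐ m' → m' ≡ nothing → m ≡ nothing
  from nothing e = e

dom-inv : ∀ {M Γ U} → M ∶ ⟨ Γ ⊢ U ⟩ → Dom Γ M
dom-inv (ax {x} {T})                 = Dom-[] x ⌜ T ⌝
dom-inv (ωr {M})                     = Dom-envω M
dom-inv (→i {Γ = Γ} {U} x∉M Γx D)    = Dom-lam (dom-inv D) x∉M Γx (,-there Γ U)
dom-inv (→'i x∉M D Γx)               = Dom-lam (dom-inv D) x∉M Γx (λ _ → refl)
dom-inv (→e D₁ D₂)                   = Dom-app (dom-inv D₁) (dom-inv D₂)
dom-inv (⊓i D₁ D₂)                   = dom-inv D₁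
dom-inv (⊑r D (⊑-typing _ Δ⊑Γ))      = Dom-⊑ᵉ Δ⊑Γ (dom-inv D)

Dom-⊓ : ∀ {Γ₁ Γ₂ M} → Dom Γ₁ M → Dom Γ₂ M → Dom (Γ₁ ⊓ᵉ Γ₂) M
Dom-⊓ {Γ₁} {Γ₂} d₁ d₂ = mkDom
  (λ {y} e → undeclared⇒∉ d₁ (proj₁ (⊓ᵐ-nothing⁻ (Γ₁ y) (Γ₂ y) (trans (sym (⊓ᵉ-at Γ₁ Γ₂ y)) e))))
  (λ y∉ → ⊓ᵉ-nothing⁺ Γ₁ Γ₂ (∉⇒undeclared d₁ y∉) (∉⇒undeclared d₂ y∉))

Dom-↑ : ∀ {Γ Y X} → Dom Γ Y → FV Y ⊆ FV X → Dom (Γ ↑ X) X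
Dom-↑ {Γ} {Y} {X} d Y⊆X = mkDom (λ e → proj₁ (↑-nothing⁻ Γ X e))
                                (λ y∉X → ↑-nothing⁺ Γ X y∉X (∉⇒undeclared d (y∉X ∘ Y⊆X)))

infix 4 _⊑⁺_
_⊑⁺_ : Env → Env → Set
Γ ⊑⁺ Δ = ∀ y → orω (Γ y) ⊑ orω (Δ y)

⊑⁺-refl : ∀ {Γ} → Γ ⊑⁺ Γ
⊑⁺-refl y = ⊑-refl

⊑⁺⇒⊑ᵉ : ∀ {Γ Δ M} → Dom Γ M → Dom Δ M → Γ ⊑⁺ Δ → Γ ⊑ᵉ Δ
⊑⁺⇒⊑ᵉ {Γ} {Δ} dΓ dΔ le y with Γ y in eΓ | Δ y in eΔ | le y
... | just U  | just V  | U⊑V = just U⊑V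
... | nothing | nothing | _   = nothing
... | just U  | nothing | _   = ⊥-elim (just≢nothing (trans (sym eΓ) (∉⇒undeclared dΓ (undeclared⇒∉ dΔ eΔ))))
... | nothing | just V  | _   = ⊥-elim (just≢nothing (trans (sym eΔ) (∉⇒undeclared dΔ (undeclared⇒∉ dΓ eΓ))))

⊑ᵐ-refl : ∀ m → m ⊑ᵐ m
⊑ᵐ-refl nothing  = nothing
⊑ᵐ-refl (just U) = just ⊑-refl

⊑ᵐ⇒⊑ : ∀ {m m'} → m ⊑ᵐ m' → orω m ⊑ orω m'
⊑ᵐ⇒⊑ nothing    = ⊑-refl
⊑ᵐ⇒⊑ (just U⊑V) = U⊑V

env-⊑ : ∀ {M Γ Δ U} → M ∶ ⟨ Γ ⊢ U ⟩ → Dom Δ M → Δ ⊑⁺ Γ → M ∶ ⟨ Δ ⊢ U ⟩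
env-⊑ D dΔ le = ⊑r D (⊑-typing ⊑-refl (⊑⁺⇒⊑ᵉ dΔ (dom-inv D) le))

env-≗ : ∀ {M Γ Δ U} → M ∶ ⟨ Γ ⊢ U ⟩ → Γ ≗ Δ → M ∶ ⟨ Δ ⊢ U ⟩
env-≗ {Γ = Γ} D Γ≗Δ = ⊑r D (⊑-typing ⊑-refl (λ y → transport (_⊑ᵐ Γ y) (Γ≗Δ y) (⊑ᵐ-refl (Γ y))))

ty-⊑ : ∀ {M Γ U V} → M ∶ ⟨ Γ ⊢ U ⟩ → U ⊑ V → M ∶ ⟨ Γ ⊢ V ⟩
ty-⊑ D U⊑V = ⊑r D (⊑-typing U⊑V (λ y → ⊑ᵐ-refl _))

ty-≡ : ∀ {M Γ U V} → U ≡ V → M ∶ ⟨ Γ ⊢ U ⟩ → M ∶ ⟨ Γ ⊢ V ⟩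
ty-≡ refl D = D

tm-≡ : ∀ {M M' Φ} → M ≡ M' → M ∶ Φ → M' ∶ Φ
tm-≡ refl D = D

⊓ᵉ-mono : ∀ {Γ₁ Γ₂ Δ₁ Δ₂} → Γ₁ ⊑⁺ Δ₁ → Γ₂ ⊑⁺ Δ₂ → (Γ₁ ⊓ᵉ Γ₂) ⊑⁺ (Δ₁ ⊓ᵉ Δ₂)
⊓ᵉ-mono {Γ₁} {Γ₂} {Δ₁} {Δ₂} p q y =
  ⊑-≈ (orω-⊓ᵉ Γ₁ Γ₂ y) ⟫ ⊑-⊓ (p y) (q y) ⟫ ⊑-≈ (≈-sym (orω-⊓ᵉ Δ₁ Δ₂ y))

[]-mono : ∀ x {U V} → U ⊑ V → [ x ∶ U ] ⊑⁺ [ x ∶ V ]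
[]-mono x {U} {V} U⊑V y with y ≟ x
... | yes refl = ≡⇒⊑ (cong orω ([]-here x U)) ⟫ U⊑V ⟫ ≡⇒⊑ (cong orω (sym ([]-here x V)))
... | no y≢x   = ≡⇒⊑ (cong orω (trans ([]-there U y≢x) (sym ([]-there V y≢x))))

var : ∀ x U → fv x ∶ ⟨ [ x ∶ U ] ⊢ U ⟩
var x ω         = env-≗ ωr envω≗[]
  where
  envω≗[] : envω (fv x) ≗ [ x ∶ ω ]
  envω≗[] y with y ≟ x
  ... | yes refl = trans (envω-in (fv x) (here refl)) (sym ([]-here x ω))
  ... | no y≢x   = trans (envω-out (fv x) (λ { (here y≡x) → y≢x y≡x })) (sym ([]-there ω y≢x))
var x (U₁ ⊓ U₂) = ⊓i (env-⊑ (var x U₁) (Dom-[] x _) ([]-mono x ⊑-⊓ˡ))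
                     (env-⊑ (var x U₂) (Dom-[] x _) ([]-mono x ⊑-⊓ʳ))
var x ⌜ T ⌝     = ax

meet : ∀ {M Γ₁ Γ₂ U₁ U₂} → M ∶ ⟨ Γ₁ ⊢ U₁ ⟩ → M ∶ ⟨ Γ₂ ⊢ U₂ ⟩ → M ∶ ⟨ Γ₁ ⊓ᵉ Γ₂ ⊢ U₁ ⊓ U₂ ⟩
meet {Γ₁ = Γ₁} {Γ₂} D₁ D₂ =
  ⊓i (env-⊑ D₁ d (λ y → ⊑-≈ (orω-⊓ᵉ Γ₁ Γ₂ y) ⟫ ⊑-⊓ˡ)) (env-⊑ D₂ d (λ y → ⊑-≈ (orω-⊓ᵉ Γ₁ Γ₂ y) ⟫ ⊑-⊓ʳ))
  where d = Dom-⊓ (dom-inv D₁) (dom-inv D₂)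

-- Abstraction, uniformly for both λ-rules: the abstracted variable receives the
-- type it has in the body's environment (ω if it is not declared there).
abs : ∀ {Q : Tm 1} {y Δ T} → y ∉ FV Q → open^ Q y ∶ ⟨ Δ ⊢ ⌜ T ⌝ ⟩ →
  lam Q ∶ ⟨ Δ ∖ y ⊢ ⌜ orω (Δ y) ⇒ T ⌝ ⟩
abs {Q} {y} {Δ} y∉Q D with Δ y in Δy
... | just U  = →i y∉Q (∖-here Δ y) (env-≗ D Δ≗)
  where
  Δ≗ : Δ ≗ ((Δ ∖ y) , y ∶ U)
  Δ≗ w with w ≟ y
  ... | yes refl = trans Δy (sym (,-here (Δ ∖ y) y U))
  ... | no w≢y   = trans (sym (∖-there Δ w≢y)) (sym (,-there (Δ ∖ y) U w≢y))
... | nothing = →'i y∉Q (env-≗ D Δ≗) (∖-here Δ y)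
  where
  Δ≗ : Δ ≗ (Δ ∖ y)
  Δ≗ w with w ≟ y
  ... | yes refl = trans Δy (sym (∖-here Δ y))
  ... | no w≢y   = sym (∖-there Δ w≢y)

-- Equivariance: typing is invariant under swapping two names

module Equivariance (a b : Var) where
  open Swap a b

  if-sw : ∀ {A : Set} (u v : A) x y →
    (if does (y ≟ sw x) then u else v) ≡ (if does (sw y ≟ x) then u else v)
  if-sw u v x y with y ≟ sw x
  ... | yes y≡swx = trans (if-yes (y ≟ sw x) y≡swx) (sym (if-yes (sw y ≟ x) (sym (sw-transpose (sym y≡swx)))))
  ... | no y≢swx  = trans (if-no (y ≟ sw x) y≢swx) (sym (if-no (sw y ≟ x) (λ e → y≢swx (sw-transpose e))))

  swap-typing : ∀ {M Γ U} → M ∶ ⟨ Γ ⊢ U ⟩ → swT M ∶ ⟨ Γ ∘ sw ⊢ U ⟩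
  swap-typing (ax {x} {T}) = env-≗ ax (if-sw (just ⌜ T ⌝) nothing x)
  swap-typing (ωr {M}) = env-≗ ωr envω≗
    where
    envω≗ : envω (swT M) ≗ (envω M ∘ sw)
    envω≗ y with y ∈? FV (swT M)
    ... | yes p = sym (envω-in M (∈-swT⁻ M p))
    ... | no ¬p = sym (envω-out M (λ q → ¬p (transport (_∈ FV (swT M)) (sw-involutive y) (∈-swT⁺ M q))))
  swap-typing (→i {M} {x} {Γ} {U} x∉M Γx D) =
    →i (λ p → x∉M (transport (_∈ FV M) (sw-involutive x) (∈-swT⁻ M p)))
       (trans (cong Γ (sw-involutive x)) Γx)
       (env-≗ (tm-≡ (swT-open M x) (swap-typing D)) (λ y → sym (if-sw (just U) (Γ (sw y)) x y)))
  swap-typing (→'i {M} {x} {Γ} x∉M D Γx) =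
    →'i (λ p → x∉M (transport (_∈ FV M) (sw-involutive x) (∈-swT⁻ M p)))
        (tm-≡ (swT-open M x) (swap-typing D))
        (trans (cong Γ (sw-involutive x)) Γx)
  swap-typing (→e {Γ₁ = Γ₁} {Γ₂} D₁ D₂) =
    env-≗ (→e (swap-typing D₁) (swap-typing D₂))
          (λ y → trans (⊓ᵉ-at (Γ₁ ∘ sw) (Γ₂ ∘ sw) y) (sym (⊓ᵉ-at Γ₁ Γ₂ (sw y))))
  swap-typing (⊓i D₁ D₂) = ⊓i (swap-typing D₁) (swap-typing D₂)
  swap-typing (⊑r D (⊑-typing U⊑V Δ⊑Γ)) = ⊑r (swap-typing D) (⊑-typing U⊑V (Δ⊑Γ ∘ sw))

-- Inverting the substitution lemma

∉-inst : ∀ (P : Tm 1) N {x} → x ∉ FV P → x ∉ FV N → x ∉ FV (P [0:= N ])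
∉-inst P N x∉P x∉N p = [ x∉P , x∉N ]′ (∈-++⁻ (FV P) (FV-inst⁻ P N p))

module Decomposition (N : Tm 0) where

  record Split (P : Tm 1) (Γ : Env) (U : UTy) (avoid : List Var) : Set where
    field
      x       : Var
      x∉avoid : x ∉ avoid
      x∉P     : x ∉ FV P
      x∉N     : x ∉ FV N
      Γ₁ Γ₂   : Env
      body    : open^ P x ∶ ⟨ Γ₁ ⊢ U ⟩
      arg     : N ∶ ⟨ Γ₂ ⊢ orω (Γ₁ x) ⟩
      covers  : ∀ z → z ≢ x → orω (Γ z) ⊑ orω (Γ₁ z) ⊓ orω (Γ₂ z)

  freshFor : (avoid : List Var) (P : Tm 1) → ∃ λ x → x ∉ avoid × x ∉ FV P × x ∉ FV N
  freshFor avoid P with fresh (avoid ++ FV P ++ FV N)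
  ... | x ,, x∉ = x ,, x∉ ∘ ∈-++⁺ˡ ,, x∉ ∘ ∈-++⁺ʳ avoid ∘ ∈-++⁺ˡ ,, x∉ ∘ ∈-++⁺ʳ avoid ∘ ∈-++⁺ʳ (FV P)

  split-hole : ∀ {Γ U} → N ∶ ⟨ Γ ⊢ U ⟩ → (avoid : List Var) → Split (bv zero) Γ U avoid
  split-hole {Γ} {U} D avoid with freshFor avoid (bv zero)
  ... | x ,, x∉a ,, x∉P ,, x∉N = record
    { x = x ; x∉avoid = x∉a ; x∉P = x∉P ; x∉N = x∉N ; Γ₁ = [ x ∶ U ] ; Γ₂ = Γ
    ; body = var x U
    ; arg = ty-≡ (cong orω (sym ([]-here x U))) D
    ; covers = λ z z≢x → ⊑-glb (⊑-ω ⟫ ≡⇒⊑ (cong orω (sym ([]-there U z≢x)))) ⊑-refl }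

  split-free : ∀ {Γ U w} → fv w ∶ ⟨ Γ ⊢ U ⟩ → (avoid : List Var) → Split (fv w) Γ U avoid
  split-free {Γ} {w = w} D avoid with freshFor avoid (fv w)
  ... | x ,, x∉a ,, x∉P ,, x∉N = record
    { x = x ; x∉avoid = x∉a ; x∉P = x∉P ; x∉N = x∉N ; Γ₁ = Γ ; Γ₂ = envω N
    ; body = D
    ; arg = ty-≡ (cong orω (sym (∉⇒undeclared (dom-inv D) x∉P))) ωr
    ; covers = λ z _ → ⊑-glb ⊑-refl (⊑-ω ⟫ ≡⇒⊑ (sym (orω-envω N z))) }

  split-ω : ∀ {Q} (P : Tm 1) (avoid : List Var) → Split P (envω Q) ω avoid
  split-ω {Q} P avoid with freshFor avoid P
  ... | x ,, x∉a ,, x∉P ,, x∉N = record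
    { x = x ; x∉avoid = x∉a ; x∉P = x∉P ; x∉N = x∉N ; Γ₁ = envω (open^ P x) ; Γ₂ = envω N
    ; body = ωr
    ; arg = ty-≡ (sym (orω-envω (open^ P x) x)) ωr
    ; covers = λ z _ → ≡⇒⊑ (orω-envω Q z)
                       ⟫ ⊑-glb (≡⇒⊑ (sym (orω-envω (open^ P x) z))) (≡⇒⊑ (sym (orω-envω N z))) }

  -- A split can be moved to any other fresh name, by swapping the two names.
  rebase : ∀ {P Γ U avoid avoid'} → Dom Γ (P [0:= N ]) → Split P Γ U avoid' →
    (x' : Var) → x' ∉ avoid → x' ∉ FV P → x' ∉ FV N → Split P Γ U avoid
  rebase {P} {Γ} dΓ S x' x'∉a x'∉P x'∉N = record
    { x = x' ; x∉avoid = x'∉a ; x∉P = x'∉P ; x∉N = x'∉N ; Γ₁ = Γ₁ ∘ sw ; Γ₂ = Γ₂ ∘ sw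
    ; body = tm-≡ (trans (swT-open P x) (cong₂ open^ (swT-fresh P x∉P x'∉P) sw-a)) (swap-typing body)
    ; arg = ty-≡ (cong (orω ∘ Γ₁) (sym sw-b)) (tm-≡ (swT-fresh N x∉N x'∉N) (swap-typing arg))
    ; covers = λ z z≢x' → ≡⇒⊑ (cong orω (Γ-sw z)) ⟫ covers (sw z) (λ e → z≢x' (trans (sw-transpose e) sw-a)) }
    where
    open Split S
    open Swap x x'
    open Equivariance x x'
    Γ-sw : ∀ z → Γ z ≡ Γ (sw z)
    Γ-sw = sw-invariant Γ (trans (∉⇒undeclared dΓ (∉-inst P N x∉P x∉N))
                                 (sym (∉⇒undeclared dΓ (∉-inst P N x'∉P x'∉N))))

  merge-arg : ∀ {x Γ₁ Γ₂ Γ₁' Γ₂'} → N ∶ ⟨ Γ₂ ⊢ orω (Γ₁ x) ⟩ → N ∶ ⟨ Γ₂' ⊢ orω (Γ₁' x) ⟩ →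
    N ∶ ⟨ Γ₂ ⊓ᵉ Γ₂' ⊢ orω ((Γ₁ ⊓ᵉ Γ₁') x) ⟩
  merge-arg {x} {Γ₁} {Γ₂} {Γ₁'} A B = ty-⊑ (meet A B) (⊑-≈ (≈-sym (orω-⊓ᵉ Γ₁ Γ₁' x)))

  merge-covers : ∀ {W W'} Γ₁ Γ₂ Γ₁' Γ₂' z → W ⊑ orω (Γ₁ z) ⊓ orω (Γ₂ z) → W' ⊑ orω (Γ₁' z) ⊓ orω (Γ₂' z) →
    W ⊓ W' ⊑ orω ((Γ₁ ⊓ᵉ Γ₁') z) ⊓ orω ((Γ₂ ⊓ᵉ Γ₂') z)
  merge-covers Γ₁ Γ₂ Γ₁' Γ₂' z p q =
    ⊑-⊓ p q ⟫ ⊓-interchange ⟫ ⊑-⊓ (⊑-≈ (≈-sym (orω-⊓ᵉ Γ₁ Γ₁' z))) (⊑-≈ (≈-sym (orω-⊓ᵉ Γ₂ Γ₂' z)))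

  -- Under a binder y of P = λ.P': if the hole of P' occurs in the body (as it does
  -- when the body's environment declares x), then N's variables survive in P[0:=N].
  hole-used : ∀ (P' : Tm 2) {x y} → x ≢ y → x ∉ FV P' → x ∈ FV (open^ (openInner P' y) x) →
    FV N ⊆ FV (subst (exts (inst N)) P')
  hole-used P' {x} {y} x≢y x∉P' x∈ w∈N
    with FV-subst⁻ (fv y ∷ₛ inst (fv x)) P' (transport (λ t → x ∈ FV t) (inst-openInner (fv x) y P') x∈)
  ... | inj₁ x∈P'                       = ⊥-elim (x∉P' x∈P')
  ... | inj₂ (zero ,, _ ,, here x≡y)    = ⊥-elim (x≢y x≡y)
  ... | inj₂ (suc zero ,, uses ,, _)    =
    uses (exts (inst N)) (transport (_ ∈_) (sym (FV-rename suc N)) w∈N)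

  -- The argument part can be chosen not to declare the binder y, which the
  -- environment of λ.P'[0:=N] does not declare either.
  record ClearedArg (x y : Var) (Γ₁ Γ₂ : Env) : Set where
    field
      Γ₂'    : Env
      arg'   : N ∶ ⟨ Γ₂' ⊢ orω (Γ₁ x) ⟩
      y-free : orω (Γ₂' y) ≡ ω
      weaker : Γ₂ ⊑⁺ Γ₂'

  clear-binder : ∀ {U} (P' : Tm 2) {x y Γ₁ Γ₂} → x ≢ y → x ∉ FV P' → y ∉ FV (subst (exts (inst N)) P') →
    open^ (openInner P' y) x ∶ ⟨ Γ₁ ⊢ U ⟩ → N ∶ ⟨ Γ₂ ⊢ orω (Γ₁ x) ⟩ → ClearedArg x y Γ₁ Γ₂
  clear-binder P' {x} {y} {Γ₁} {Γ₂} x≢y x∉P' y∉ D₁ D₂ with Γ₁ x in Γ₁x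
  ... | nothing = record { Γ₂' = envω N ; arg' = ty-≡ (cong orω (sym Γ₁x)) ωr ; y-free = orω-envω N y
                         ; weaker = λ z → ⊑-ω ⟫ ≡⇒⊑ (sym (orω-envω N z)) }
  ... | just V  = record { Γ₂' = Γ₂ ; arg' = ty-≡ (cong orω (sym Γ₁x)) D₂ ; weaker = ⊑⁺-refl {Γ₂}
                         ; y-free = cong orω (∉⇒undeclared (dom-inv D₂) (y∉ ∘ hole-used P' x≢y x∉P' x∈)) }
    where
    x∈ : x ∈ FV (open^ (openInner P' y) x)
    x∈ with x ∈? FV (open^ (openInner P' y) x)
    ... | yes p = p
    ... | no ¬p = ⊥-elim (just≢nothing (trans (sym Γ₁x) (∉⇒undeclared (dom-inv D₁) ¬p)))

  mutual
    -- The decomposition, by induction on the typing of P[0:=N].  The term is given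
    -- through an equation, so that the recursion is structural on the derivation.
    split : ∀ {Q Γ U} (P : Tm 1) → P [0:= N ] ≡ Q → Q ∶ ⟨ Γ ⊢ U ⟩ → (avoid : List Var) → Split P Γ U avoid
    split (bv zero)     refl D avoid = split-hole D avoid
    split (bv (suc ())) _    _ _
    split (fv w)        refl D avoid = split-free D avoid
    split P eq (ωr {Q})   avoid = split-ω {Q} P avoid
    split P eq (⊓i D₁ D₂) avoid = split-⊓ P eq D₁ D₂ avoid
    split P eq (⊑r D (⊑-typing U⊑V Γ'⊑Γ)) avoid =
      record { x = x ; x∉avoid = x∉avoid ; x∉P = x∉P ; x∉N = x∉N ; Γ₁ = Γ₁ ; Γ₂ = Γ₂ ; arg = arg
             ; body = ty-⊑ body U⊑V ; covers = λ z z≢x → ⊑ᵐ⇒⊑ (Γ'⊑Γ z) ⟫ covers z z≢x }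
      where open Split (split P eq D avoid)
    split (app P₁ P₂) refl (→e D₁ D₂)       avoid = split-app P₁ P₂ D₁ D₂ avoid
    split (lam P')    refl (→i {x = y} {Γ} {U} y∉ Γy D') avoid =
      split-lam P' y∉ Γy (,-there Γ U) (cong orω (,-here Γ y U)) D' avoid
    split (lam P')    refl (→'i y∉ D' Γy)   avoid = split-lam P' y∉ Γy (λ _ → refl) (cong orω Γy) D' avoid
    split (lam P')    () ax          _
    split (app P₁ P₂) () ax          _
    split (lam P')    () (→e _ _)    _
    split (app P₁ P₂) () (→i _ _ _)  _
    split (app P₁ P₂) () (→'i _ _ _) _

    split-⊓ : ∀ {Q Γ U₁ U₂} (P : Tm 1) → P [0:= N ] ≡ Q → Q ∶ ⟨ Γ ⊢ U₁ ⟩ → Q ∶ ⟨ Γ ⊢ U₂ ⟩ →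
      (avoid : List Var) → Split P Γ (U₁ ⊓ U₂) avoid
    split-⊓ P eq D₁ D₂ avoid = record
      { x = A.x ; x∉avoid = A.x∉avoid ; x∉P = A.x∉P ; x∉N = A.x∉N
      ; Γ₁ = A.Γ₁ ⊓ᵉ B.Γ₁ ; Γ₂ = A.Γ₂ ⊓ᵉ B.Γ₂
      ; body = meet A.body B.body
      ; arg = merge-arg {A.x} {A.Γ₁} {A.Γ₂} {B.Γ₁} A.arg B.arg
      ; covers = λ z z≢x → ⊑-glb ⊑-refl ⊑-refl
                           ⟫ merge-covers A.Γ₁ A.Γ₂ B.Γ₁ B.Γ₂ z (A.covers z z≢x) (B.covers z z≢x) }
      where
      module A = Split (split P eq D₁ avoid)
      module B = Split (rebase (transport (Dom _) (sym eq) (dom-inv D₂)) (split P eq D₂ avoid)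
                               A.x A.x∉avoid A.x∉P A.x∉N)

    split-app : ∀ {Γa Γb U T} (P₁ P₂ : Tm 1) → P₁ [0:= N ] ∶ ⟨ Γa ⊢ ⌜ U ⇒ T ⌝ ⟩ → P₂ [0:= N ] ∶ ⟨ Γb ⊢ U ⟩ →
      (avoid : List Var) → Split (app P₁ P₂) (Γa ⊓ᵉ Γb) ⌜ T ⌝ avoid
    split-app {Γa} {Γb} P₁ P₂ D₁ D₂ avoid = record
      { x = A.x ; x∉avoid = x∉avoid ; x∉P = x∉P ; x∉N = A.x∉N
      ; Γ₁ = A.Γ₁ ⊓ᵉ B.Γ₁ ; Γ₂ = A.Γ₂ ⊓ᵉ B.Γ₂
      ; body = →e A.body B.body
      ; arg = merge-arg {A.x} {A.Γ₁} {A.Γ₂} {B.Γ₁} A.arg B.arg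
      ; covers = λ z z≢x → ⊑-≈ (orω-⊓ᵉ Γa Γb z)
                           ⟫ merge-covers A.Γ₁ A.Γ₂ B.Γ₁ B.Γ₂ z (A.covers z z≢x) (B.covers z z≢x) }
      where
      module A = Split (split P₁ refl D₁ (avoid ++ FV P₂))
      x∉avoid : A.x ∉ avoid
      x∉avoid = A.x∉avoid ∘ ∈-++⁺ˡ
      x∉P₂ : A.x ∉ FV P₂
      x∉P₂ = A.x∉avoid ∘ ∈-++⁺ʳ avoid
      x∉P : A.x ∉ FV P₁ ++ FV P₂
      x∉P p = [ A.x∉P , x∉P₂ ]′ (∈-++⁻ (FV P₁) p)
      module B = Split (rebase (dom-inv D₂) (split P₂ refl D₂ avoid) A.x x∉avoid x∉P₂ A.x∉N)

    split-lam : ∀ (P' : Tm 2) {y Γ Δ U T} → y ∉ FV (subst (exts (inst N)) P') → Γ y ≡ nothing →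
      (∀ {z} → z ≢ y → Δ z ≡ Γ z) → orω (Δ y) ≡ U →
      open^ (subst (exts (inst N)) P') y ∶ ⟨ Δ ⊢ ⌜ T ⌝ ⟩ →
      (avoid : List Var) → Split (lam P') Γ ⌜ U ⇒ T ⌝ avoid
    split-lam P' {y} {Γ} {Δ} {U} {T} y∉ Γy Δ≡Γ Δy D' avoid = record
      { x = R.x ; x∉avoid = R.x∉avoid ∘ there ; x∉P = x∉P' ; x∉N = R.x∉N
      ; Γ₁ = R.Γ₁ ∖ y ; Γ₂ = C.Γ₂'
      ; body = ty-⊑ (abs y∉B (tm-≡ (openInner-open (fv R.x) y P') R.body)) (⊑-⇒ U⊑ ⊑-refl)
      ; arg = ty-≡ (cong orω (sym (∖-there R.Γ₁ x≢y))) C.arg'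
      ; covers = covers }
      where
      module R = Split (split (openInner P' y) (openInner-open N y P') D' (y ∷ avoid))
      x≢y : R.x ≢ y
      x≢y = R.x∉avoid ∘ here
      x∉P' : R.x ∉ FV P'
      x∉P' = R.x∉P ∘ FV-subst⁺ (fv y ∷ₛ bv) P'
      B : Tm 1
      B = subst (exts (inst (fv R.x))) P'
      y∉B : y ∉ FV B
      y∉B p with FV-subst⁻ (exts (inst (fv R.x))) P' p
      ... | inj₁ y∈P'                        = y∉ (FV-subst⁺ (exts (inst N)) P' y∈P')
      ... | inj₂ (suc zero ,, _ ,, here y≡x) = x≢y (sym y≡x)
      U⊑ : U ⊑ orω (R.Γ₁ y)
      U⊑ = ≡⇒⊑ (sym Δy) ⟫ R.covers y (x≢y ∘ sym) ⟫ ⊑-⊓ˡ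
      module C = ClearedArg (clear-binder P' x≢y x∉P' y∉ R.body R.arg)
      covers : ∀ z → z ≢ R.x → orω (Γ z) ⊑ orω ((R.Γ₁ ∖ y) z) ⊓ orω (C.Γ₂' z)
      covers z z≢x with z ≟ y
      ... | yes refl = ≡⇒⊑ (cong orω Γy) ⟫ ⊑-glb (≡⇒⊑ (cong orω (sym (∖-here R.Γ₁ y)))) (≡⇒⊑ (sym C.y-free))
      ... | no z≢y   = ≡⇒⊑ (cong orω (sym (Δ≡Γ z≢y))) ⟫ R.covers z z≢x
                       ⟫ ⊑-⊓ (≡⇒⊑ (cong orω (sym (∖-there R.Γ₁ z≢y)))) (C.weaker z)

-- Subject expansion

Expands : Tm 0 → Tm 0 → Set
Expands X Y = ∀ {Γ U} → Y ∶ ⟨ Γ ⊢ U ⟩ → X ∶ ⟨ Γ ↑ X ⊢ U ⟩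

Expands-≡ : ∀ {X X' Y Y'} → X ≡ X' → Y ≡ Y' → Expands X Y → Expands X' Y'
Expands-≡ refl refl e = e

↑-self : ∀ {Γ M} → Dom Γ M → Γ ≗ Γ ↑ M
↑-self {Γ} {M} d y with Γ y in Γy | y ∈? FV M
... | just U  | _     = refl
... | nothing | yes p = ⊥-elim (undeclared⇒∉ d Γy p)
... | nothing | no _  = refl

↑-↑ : ∀ {Γ X Z} → FV X ⊆ FV Z → (Γ ↑ X) ↑ Z ≗ Γ ↑ Z
↑-↑ {Γ} {X} {Z} X⊆Z y with Γ y | y ∈? FV X | y ∈? FV Z
... | just U  | _     | _     = refl
... | nothing | yes _ | yes _ = refl
... | nothing | yes p | no ¬q = ⊥-elim (¬q (X⊆Z p))
... | nothing | no _  | _     = refl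

expands-refl : ∀ {M} → Expands M M
expands-refl D = env-≗ D (↑-self (dom-inv D))

expands-trans : ∀ {X Y Z} → FV X ⊆ FV Z → Expands Z X → Expands X Y → Expands Z Y
expands-trans {X} {Y} {Z} X⊆Z eZX eXY D = env-≗ (eZX (eXY D)) (↑-↑ {X = X} {Z} X⊆Z)

NotSub : ∀ {M Φ} → M ∶ Φ → Set
NotSub (⊑r _ _) = ⊥
NotSub _        = ⊤

ExpandsSD : Tm 0 → Tm 0 → Set
ExpandsSD X Y = ∀ {Γ T} (D : Y ∶ ⟨ Γ ⊢ ⌜ T ⌝ ⟩) → NotSub D → X ∶ ⟨ Γ ↑ X ⊢ ⌜ T ⌝ ⟩

↑-mono : ∀ {Γ Δ} X → Δ ⊑ᵉ Γ → (Δ ↑ X) ⊑ᵉ (Γ ↑ X)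
↑-mono {Γ} {Δ} X Δ⊑Γ y with Δ y | Γ y | Δ⊑Γ y | does (y ∈? FV X)
... | nothing | nothing | nothing | true  = just ⊑-refl
... | nothing | nothing | nothing | false = nothing
... | just _  | just _  | just U⊑V | _    = just U⊑V

-- The ω-, intersection and subsumption rules commute with expansion, so it
-- suffices to expand syntax-directed derivations.
expands-from-SD : ∀ {X Y} → FV Y ⊆ FV X → ExpandsSD X Y → Expands X Y
expands-from-SD Y⊆X e D@ax               = e D _
expands-from-SD {X} {Y} Y⊆X e ωr          =
  env-⊑ ωr (Dom-↑ (Dom-envω Y) Y⊆X) (λ y → ≡⇒⊑ (trans (orω-↑ (envω Y) X y)
                                                (trans (orω-envω Y y) (sym (orω-envω X y)))))
expands-from-SD Y⊆X e D@(→i _ _ _)       = e D _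
expands-from-SD Y⊆X e D@(→'i _ _ _)      = e D _
expands-from-SD Y⊆X e D@(→e _ _)         = e D _
expands-from-SD Y⊆X e (⊓i D₁ D₂)         = ⊓i (expands-from-SD Y⊆X e D₁) (expands-from-SD Y⊆X e D₂)
expands-from-SD {X} Y⊆X e (⊑r D (⊑-typing U⊑V Δ⊑Γ)) =
  ⊑r (expands-from-SD Y⊆X e D) (⊑-typing U⊑V (↑-mono X Δ⊑Γ))

-- A β-redex expands its contractum: split the typing of P[0:=N] and rebuild
-- it with the λ-rule and the application rule.
expand-redex : ∀ (P : Tm 1) N → Expands (app (lam P) N) (P [0:= N ])
expand-redex P N = expands-from-SD (FV-inst⁻ P N) redex
  where
  redex : ExpandsSD (app (lam P) N) (P [0:= N ])
  redex {Γ} D _ = env-⊑ (→e (abs x∉P body) arg) (Dom-↑ (dom-inv D) (FV-inst⁻ P N)) Γ↑⊑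
    where
    open Decomposition N
    open Split (split P refl D [])
    Γ↑⊑ : (Γ ↑ app (lam P) N) ⊑⁺ ((Γ₁ ∖ x) ⊓ᵉ Γ₂)
    Γ↑⊑ y with y ≟ x
    ... | yes refl = ≡⇒⊑ (trans (orω-↑ Γ (app (lam P) N) y)
                                (cong orω (trans Γx (sym (⊓ᵉ-nothing⁺ (Γ₁ ∖ x) Γ₂ (∖-here Γ₁ x) Γ₂x)))))
      where
      Γx = ∉⇒undeclared (dom-inv D) (∉-inst P N x∉P x∉N)
      Γ₂x = ∉⇒undeclared (dom-inv arg) x∉N
    ... | no y≢x   = ≡⇒⊑ (orω-↑ Γ (app (lam P) N) y) ⟫ covers y y≢x
                     ⟫ ⊑-⊓ (≡⇒⊑ (cong orω (sym (∖-there Γ₁ y≢x)))) ⊑-refl ⟫ ⊑-≈ (≈-sym (orω-⊓ᵉ (Γ₁ ∖ x) Γ₂ y))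

expand-app : ∀ {A A' B B'} → Expands A A' → Expands B B' → FV A' ⊆ FV A → FV B' ⊆ FV B →
  ExpandsSD (app A B) (app A' B')
expand-app {A} {A'} {B} {B'} eA eB A'⊆A B'⊆B D@(→e {Γ₁ = Γa} {Γb} D₁ D₂) _ =
  env-⊑ (→e (eA D₁) (eB D₂)) (Dom-↑ (dom-inv D) (++⁺ A'⊆A B'⊆B)) Γ↑⊑
  where
  Γ↑⊑ : ((Γa ⊓ᵉ Γb) ↑ app A B) ⊑⁺ ((Γa ↑ A) ⊓ᵉ (Γb ↑ B))
  Γ↑⊑ y = ≡⇒⊑ (orω-↑ (Γa ⊓ᵉ Γb) (app A B) y)
          ⟫ ⊓ᵉ-mono {Γa} {Γb} {Γa ↑ A} {Γb ↑ B} (λ w → ≡⇒⊑ (sym (orω-↑ Γa A w)))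
                                               (λ w → ≡⇒⊑ (sym (orω-↑ Γb B w))) y

mutual
  -- One-step expansion, by induction on the reduction.  Reductions below a
  -- binder act on open terms, so the statement is made for every closing substitution.
  expand-step : ∀ {n} {M M' : Tm n} → M ▷β M' → (σ : Fin n → Tm 0) → Expands (subst σ M) (subst σ M')
  expand-step (beta {M = P} {N}) σ =
    Expands-≡ refl (sym (subst-inst σ P N)) (expand-redex (subst (exts σ) P) (subst σ N))
  expand-step r@(ξlam r')  σ = expands-from-SD (FV-reduce r σ) (expand-lam r' σ)
  expand-step r@(ξappl r') σ =
    expands-from-SD (FV-reduce r σ) (expand-app (expand-step r' σ) expands-refl (FV-reduce r' σ) (λ p → p))
  expand-step r@(ξappr r') σ =
    expands-from-SD (FV-reduce r σ) (expand-app expands-refl (expand-step r' σ) (λ p → p) (FV-reduce r' σ))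

  expand-lam : ∀ {n} {M M' : Tm (suc n)} → M ▷β M' → (σ : Fin n → Tm 0) →
    ExpandsSD (lam (subst (exts σ) M)) (lam (subst (exts σ) M'))
  expand-lam r σ (→i {x = y} {Γ} {U} y∉ Γy D') _ =
    expand-lam-body r σ y∉ Γy (,-there Γ U) (cong orω (,-here Γ y U)) D'
  expand-lam r σ (→'i y∉ D' Γy) _ = expand-lam-body r σ y∉ Γy (λ _ → refl) (cong orω Γy) D'

  -- The body is renamed to a name z fresh for
  -- the expanded body B, expanded by induction, and abstracted again.
  expand-lam-body : ∀ {n} {M M' : Tm (suc n)} → M ▷β M' → (σ : Fin n → Tm 0) → ∀ {y Γ Δ U T} →
    y ∉ FV (subst (exts σ) M') → Γ y ≡ nothing → (∀ {w} → w ≢ y → Δ w ≡ Γ w) → orω (Δ y) ≡ U →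
    open^ (subst (exts σ) M') y ∶ ⟨ Δ ⊢ ⌜ T ⌝ ⟩ →
    lam (subst (exts σ) M) ∶ ⟨ Γ ↑ lam (subst (exts σ) M) ⊢ ⌜ U ⇒ T ⌝ ⟩
  expand-lam-body {M = M} {M'} r σ {y} {Γ} {Δ} {U} {T} y∉B' Γy Δ≡Γ Δy D' =
    ty-≡ (cong (λ V → ⌜ V ⇒ T ⌝) Ez≡U) (env-≗ (abs z∉B IH) env≗)
    where
    B  = subst (exts σ) M
    B' = subst (exts σ) M'
    z = proj₁ (fresh (y ∷ FV B ++ FV B'))
    z∉ = proj₂ (fresh (y ∷ FV B ++ FV B'))
    z≢y : z ≢ y
    z≢y = z∉ ∘ here
    z∉B : z ∉ FV B
    z∉B = z∉ ∘ there ∘ ∈-++⁺ˡ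
    z∉B' : z ∉ FV B'
    z∉B' = z∉ ∘ there ∘ ∈-++⁺ʳ (FV B)
    Γz : Γ z ≡ nothing
    Γz = ∉⇒undeclared (Dom-lam {M = B'} (dom-inv D') y∉B' Γy Δ≡Γ) z∉B'
    open Swap y z
    open Equivariance y z
    E : Env
    E = Δ ∘ sw
    IH : open^ B z ∶ ⟨ E ↑ open^ B z ⊢ ⌜ T ⌝ ⟩
    IH = Expands-≡ (sym (open-exts σ M z)) (sym (open-exts σ M' z)) (expand-step r (fv z ∷ₛ σ))
           (tm-≡ (trans (swT-open B' y) (cong₂ open^ (swT-fresh B' y∉B' z∉B') sw-a)) (swap-typing D'))
    Ez≡U : orω ((E ↑ open^ B z) z) ≡ U
    Ez≡U = trans (orω-↑ E (open^ B z) z) (trans (cong (orω ∘ Δ) sw-b) Δy)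
    E≡Γ : ∀ {w} → w ≢ z → E w ≡ Γ w
    E≡Γ {w} w≢z with w ≟ y
    ... | yes refl = trans (cong Δ sw-a) (trans (Δ≡Γ z≢y) (trans Γz (sym Γy)))
    ... | no w≢y   = trans (cong Δ (sw-other w≢y w≢z)) (Δ≡Γ w≢y)
    env≗ : ((E ↑ open^ B z) ∖ z) ≗ (Γ ↑ lam B)
    env≗ w with w ≟ z
    ... | yes refl = trans (∖-here (E ↑ open^ B z) z) (sym (↑-nothing⁺ Γ (lam B) z∉B Γz))
    ... | no w≢z   = trans (∖-there (E ↑ open^ B z) w≢z)
                           (↑-cong {E} {Γ} {open^ B z} {lam B} (E≡Γ w≢z)
                                   (λ p → FV-open⁻ B z p w≢z) (FV-subst⁺ (inst (fv z)) B))

expand-step₀ : ∀ {M M' : Tm 0} → M ▷β M' → Expands M M'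
expand-step₀ {M} {M'} r = Expands-≡ (subst-closed M) (subst-closed M') (expand-step r (λ ()))

expands* : ∀ {M N : Tm 0} → M ▷β* N → Expands M N
expands* ε        = expands-refl
expands* (r ◅ rs) = expands-trans (FV-reduce₀ r) (expand-step₀ r) (expands* rs)

corollary3p12 : ∀ {M N : Tm 0} {Γ : Env} {U : UTy} →
    N ∶ ⟨ Γ ⊢ U ⟩ → M ▷β* N → M ∶ ⟨ Γ ↑ M ⊢ U ⟩
corollary3p12 D rs = expands* rs D
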